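{- Let $\Delta$ be a program (a finite list of $D$-formulas) and $G$ a goal ($G$-formula) of the language Prolog$_{\oplus}$. Then the procedure $pv(\Delta,G)$ is a success if and only if $G$ follows from $!\Delta$ in intuitionistic linear logic.
   Context: Syntax of Prolog$_{\oplus}$ (first-order; $A$ ranges over atomic formulas): $G ::= A \mid G\otimes G \mid \exists x\, G$ (goals); $C ::= A \mid G\supset A \mid \forall x\, C$ (Horn clauses); $D ::= \,!C \mid D\oplus D$ (choice-disjunctive clauses). Here $\otimes$ is multiplicative conjunction, $\oplus$ additive disjunction, $!$ the exponential "of course", and $\supset$ implication (the paper writes $\oplus$ with a custom macro for the additive disjunction). A program $\Delta$ is a list of $D$-formulas ($::$ is list cons, $nil$ the empty list); $!\Delta$ denotes the program formulas each prefixed by $!$. $\mathcal P$ denotes a set of Horn clauses (possibly prefixed by $!$). The procedure $pv$ is defined by the following rules (success means some derivation using these rules exists; terms $t$ are chosen arbitrarily): 1. $pv(\Delta,G)$ if $pv_D^\Uparrow(nil,\Delta,G)$. 2. $pv_D^\Uparrow(\mathcal P, !C::\Delta, G)$ if $pv_D^\Uparrow(\{!C\}\cup\mathcal P,\Delta,G)$. 3. $pv_D^\Uparrow(\mathcal P,(D_0\oplus D_1)::\Delta,G)$ if $pv_D^\Uparrow(\mathcal P,D_0::\Delta,G)$ and $pv_D^\Uparrow(\mathcal P,D_1::\Delta,G)$. 4. $pv_D^\Uparrow(\mathcal P,nil,G)$ if $pv_G(\mathcal P,G)$. 5. $pv_D^\Downarrow(A,\mathcal P,A)$ (success). 6. $pv_D^\Downarrow(G_0\supset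 A,\mathcal P,A)$ if $pv_G(\mathcal P,G_0)$. 7. $pv_D^\Downarrow(\forall x\,D,\mathcal P,A)$ if $pv_D^\Downarrow([t/x]D,\mathcal P,A)$ for some term $t$. 8. $pv_G(\mathcal P,A)$ if $D\in\mathcal P$ and $pv_D^\Downarrow(D,\mathcal P,A)$. 9. $pv_G(\mathcal P,G_0\otimes G_1)$ if $pv_G(\mathcal P,G_0)$ and $pv_G(\mathcal P,G_1)$. 10. $pv_G(\mathcal P,\exists x\,G_0)$ if $pv_G(\mathcal P,[t/x]G_0)$ for some term $t$. -}

module Defs where

open import Data.Nat using (ℕ; zero; suc)
open import Data.List using (List; []; _∷_; _++_; map)
open import Data.List.Relation.Unary.All using (All)
open import Data.List.Membership.Propositional using (_∈_)
open import Data.List.Relation.Binary.Permutation.Propositional using (_↭_)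

-- First-order terms (de Bruijn variables; function symbols named by ℕ)

data Term : Set where
  var : ℕ → Term
  fn  : ℕ → List Term → Term

mutual
  substT : (ℕ → Term) → Term → Term
  substT σ (var x)   = σ x
  substT σ (fn f ts) = fn f (substTs σ ts)

  substTs : (ℕ → Term) → List Term → List Term
  substTs σ []       = []
  substTs σ (t ∷ ts) = substT σ t ∷ substTs σ ts

shiftT : Term → Term
shiftT = substT (λ x → var (suc x))

exts : (ℕ → Term) → ℕ → Term
exts σ zero    = var zero
exts σ (suc x) = shiftT (σ x)

infixr 6 _⊗_
infixr 5 _⊕_
infixr 4 _⊸_

data Formula : Set where
  atom : ℕ → List Term → Formula
  𝟏 ⊤ 𝟎 : Formula
  _⊗_ _&_ _⊕_ _⊸_ : Formula → Formula → Formula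
  !_ : Formula → Formula
  ∀' ∃' : Formula → Formula             -- bind de Bruijn variable 0

substF : (ℕ → Term) → Formula → Formula
substF σ (atom p ts) = atom p (substTs σ ts)
substF σ 𝟏 = 𝟏
substF σ ⊤ = ⊤
substF σ 𝟎 = 𝟎
substF σ (A ⊗ B) = substF σ A ⊗ substF σ B
substF σ (A & B) = substF σ A & substF σ B
substF σ (A ⊕ B) = substF σ A ⊕ substF σ B
substF σ (A ⊸ B) = substF σ A ⊸ substF σ B
substF σ (! A) = ! substF σ A
substF σ (∀' A) = ∀' (substF (exts σ) A)
substF σ (∃' A) = ∃' (substF (exts σ) A)

inst : Term → Formula → Formula
inst t = substF (λ { zero → t ; (suc x) → var x })

-- shift all free variables (used for eigenvariable conditions)
shiftF : Formula → Formula
shiftF = substF (λ x → var (suc x))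

-- intuitionistic implication, via Girard's translation  G ⊃ A := !G ⊸ A
infixr 4 _⊃_
_⊃_ : Formula → Formula → Formula
G ⊃ A = (! G) ⊸ A

infix 3 _⊢_

data _⊢_ : List Formula → Formula → Set where
  id   : ∀ {A} → A ∷ [] ⊢ A
  exch : ∀ {Γ Δ C} → Γ ↭ Δ → Γ ⊢ C → Δ ⊢ C
  𝟏R   : [] ⊢ 𝟏
  𝟏L   : ∀ {Γ C} → Γ ⊢ C → 𝟏 ∷ Γ ⊢ C
  ⊤R   : ∀ {Γ} → Γ ⊢ ⊤
  𝟎L   : ∀ {Γ C} → 𝟎 ∷ Γ ⊢ C
  ⊗R   : ∀ {Γ Δ A B} → Γ ⊢ A → Δ ⊢ B → Γ ++ Δ ⊢ A ⊗ B
  ⊗L   : ∀ {Γ A B C} → A ∷ B ∷ Γ ⊢ C → (A ⊗ B) ∷ Γ ⊢ C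
  &R   : ∀ {Γ A B} → Γ ⊢ A → Γ ⊢ B → Γ ⊢ A & B
  &L₁  : ∀ {Γ A B C} → A ∷ Γ ⊢ C → (A & B) ∷ Γ ⊢ C
  &L₂  : ∀ {Γ A B C} → B ∷ Γ ⊢ C → (A & B) ∷ Γ ⊢ C
  ⊕R₁  : ∀ {Γ A B} → Γ ⊢ A → Γ ⊢ A ⊕ B
  ⊕R₂  : ∀ {Γ A B} → Γ ⊢ B → Γ ⊢ A ⊕ B
  ⊕L   : ∀ {Γ A B C} → A ∷ Γ ⊢ C → B ∷ Γ ⊢ C → (A ⊕ B) ∷ Γ ⊢ C
  ⊸R   : ∀ {Γ A B} → A ∷ Γ ⊢ B → Γ ⊢ A ⊸ B
  ⊸L   : ∀ {Γ Δ A B C} → Γ ⊢ A → B ∷ Δ ⊢ C → (A ⊸ B) ∷ Γ ++ Δ ⊢ C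
  !R   : ∀ {Γ A} → map !_ Γ ⊢ A → map !_ Γ ⊢ ! A
  !W   : ∀ {Γ A C} → Γ ⊢ C → ! A ∷ Γ ⊢ C
  !C   : ∀ {Γ A C} → ! A ∷ ! A ∷ Γ ⊢ C → ! A ∷ Γ ⊢ C
  !D   : ∀ {Γ A C} → A ∷ Γ ⊢ C → ! A ∷ Γ ⊢ C
  ∀R   : ∀ {Γ A} → map shiftF Γ ⊢ A → Γ ⊢ ∀' A
  ∀L   : ∀ {Γ A C} (t : Term) → inst t A ∷ Γ ⊢ C → ∀' A ∷ Γ ⊢ C
  ∃R   : ∀ {Γ A} (t : Term) → Γ ⊢ inst t A → Γ ⊢ ∃' A
  ∃L   : ∀ {Γ A C} → A ∷ map shiftF Γ ⊢ shiftF C → ∃' A ∷ Γ ⊢ C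

data IsGoal : Formula → Set where
  atom : ∀ p ts → IsGoal (atom p ts)
  _⊗_  : ∀ {G₀ G₁} → IsGoal G₀ → IsGoal G₁ → IsGoal (G₀ ⊗ G₁)
  ∃'   : ∀ {G} → IsGoal G → IsGoal (∃' G)

data IsClause : Formula → Set where
  atom : ∀ p ts → IsClause (atom p ts)
  imp  : ∀ {G p ts} → IsGoal G → IsClause (G ⊃ atom p ts)
  ∀'   : ∀ {C} → IsClause C → IsClause (∀' C)

data IsD : Formula → Set where
  !_  : ∀ {C} → IsClause C → IsD (! C)
  _⊕_ : ∀ {D₀ D₁} → IsD D₀ → IsD D₁ → IsD (D₀ ⊕ D₁)

mutual
  data pvD⇑ : List Formula → List Formula → Formula → Set where
    r2 : ∀ {𝒫 C Δ G} → pvD⇑ (! C ∷ 𝒫) Δ G → pvD⇑ 𝒫 (! C ∷ Δ) G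
    r3 : ∀ {𝒫 D₀ D₁ Δ G} → pvD⇑ 𝒫 (D₀ ∷ Δ) G → pvD⇑ 𝒫 (D₁ ∷ Δ) G
       → pvD⇑ 𝒫 ((D₀ ⊕ D₁) ∷ Δ) G
    r4 : ∀ {𝒫 G} → pvG 𝒫 G → pvD⇑ 𝒫 [] G

  data pvD⇓ : Formula → List Formula → Formula → Set where
    r5  : ∀ {𝒫 p ts} → pvD⇓ (atom p ts) 𝒫 (atom p ts)
    r6  : ∀ {G₀ 𝒫 p ts} → pvG 𝒫 G₀ → pvD⇓ (G₀ ⊃ atom p ts) 𝒫 (atom p ts)
    r7  : ∀ {D 𝒫 A} (t : Term) → pvD⇓ (inst t D) 𝒫 A → pvD⇓ (∀' D) 𝒫 A
    -- members of 𝒫 are of the form !C; the clause C is what is backchained on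
    r8! : ∀ {C 𝒫 A} → pvD⇓ C 𝒫 A → pvD⇓ (! C) 𝒫 A

  data pvG : List Formula → Formula → Set where
    r8  : ∀ {𝒫 D p ts} → D ∈ 𝒫 → pvD⇓ D 𝒫 (atom p ts) → pvG 𝒫 (atom p ts)
    r9  : ∀ {𝒫 G₀ G₁} → pvG 𝒫 G₀ → pvG 𝒫 G₁ → pvG 𝒫 (G₀ ⊗ G₁)
    r10 : ∀ {𝒫 G₀} (t : Term) → pvG 𝒫 (inst t G₀) → pvG 𝒫 (∃' G₀)

pv : List Formula → Formula → Set
pv Δ G = pvD⇑ [] Δ G

{-# OPTIONS --safe #-}
module Submission where

-- Soundness: every rule of pv is a derived rule of linear logic over the banged
-- program, rule 3 being ⊕L; the D-formulas are derelicted only at the very end.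
--
-- Completeness is a realizability argument. Fix the program 𝒫 reached along one
-- branch of pv. A left formula holds in 𝒫 if it is a clause every resolution step
-- on which pvG 𝒫 already derives, or !F with F holding, or F₀ ⊕ F₁ with F₀ or F₁
-- holding. Every member of 𝒫 holds by rule 8, so along each branch all of !Δ
-- holds. By the subformula property of the cut-free calculus, a proof of Γ ⊢ G
-- only mentions such left formulas, and goals or banged goals on the right, and
-- induction on the proof turns it into pvG 𝒫 G once all of Γ holds.

open import Defs
open import Data.List using (List; map; []; _∷_; _++_; [_])
open import Data.List.Properties using (++-identityʳ)
open import Data.List.Relation.Unary.All using (All; []; _∷_; tabulate)
open import Data.List.Relation.Unary.All.Properties using (++⁻)
open import Data.List.Relation.Unary.Any using (here)
open import Data.List.Membership.Propositional using (_∈_)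
open import Data.List.Membership.Propositional.Properties using (∈-∃++; ∈-map⁺; ∈-map⁻; ∈-++⁺ʳ)
open import Data.List.Relation.Binary.Subset.Propositional using (_⊆_)
open import Data.List.Relation.Binary.Subset.Propositional.Properties using (⊆-refl; ⊆-trans; xs⊆x∷xs)
open import Data.List.Relation.Binary.Permutation.Propositional using (↭-sym; prep)
open import Data.List.Relation.Binary.Permutation.Propositional.Properties using (shift; ++-comm; All-resp-↭)
open import Data.Product using (_×_; _,_)
open import Relation.Binary.PropositionalEquality using (refl; subst; sym)

to-front : ∀ Φ {A Ψ X} → Φ ++ A ∷ Ψ ⊢ X → A ∷ Φ ++ Ψ ⊢ X
to-front Φ = exch (shift _ Φ _)

from-front : ∀ Φ {A Ψ X} → A ∷ Φ ++ Ψ ⊢ X → Φ ++ A ∷ Ψ ⊢ X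
from-front Φ = exch (↭-sym (shift _ Φ _))

weaken⋆ : ∀ Γ {Θ X} → Θ ⊢ X → map !_ Γ ++ Θ ⊢ X
weaken⋆ []      d = d
weaken⋆ (A ∷ Γ) d = !W (weaken⋆ Γ d)

contract-∈ : ∀ {A Θ X} → ! A ∈ Θ → ! A ∷ Θ ⊢ X → Θ ⊢ X
contract-∈ {A} m d with Φ , Ψ , refl ← ∈-∃++ m =
  from-front Φ (!C (exch (prep (! A) (shift (! A) Φ Ψ)) d))

contract⋆ : ∀ Γ {Θ X} → All (λ A → ! A ∈ Θ) Γ → map !_ Γ ++ Θ ⊢ X → Θ ⊢ X
contract⋆ []      []       d = d
contract⋆ (A ∷ Γ) (m ∷ ms) d = contract⋆ Γ ms (contract-∈ (∈-++⁺ʳ (map !_ Γ) m) d)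

contract-duplicate : ∀ Γ {X} → map !_ Γ ++ map !_ Γ ⊢ X → map !_ Γ ⊢ X
contract-duplicate Γ = contract⋆ Γ (tabulate (∈-map⁺ !_))

derelict⋆ : ∀ Δ {Θ X} → Δ ++ Θ ⊢ X → map !_ Δ ++ Θ ⊢ X
derelict⋆ []      d = d
derelict⋆ (D ∷ Δ) d = !D (to-front (map !_ Δ) (derelict⋆ Δ (from-front Δ d)))

derelict-all : ∀ {Δ X} → Δ ⊢ X → map !_ Δ ⊢ X
derelict-all {Δ} {X} d =
  subst (_⊢ X) (++-identityʳ (map !_ Δ))
    (derelict⋆ Δ (subst (_⊢ X) (sym (++-identityʳ Δ)) d))

mutual
  pvG-sound : ∀ {Γ G} → pvG (map !_ Γ) G → map !_ Γ ⊢ G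
  pvG-sound (r8 m d) with _ , _ , refl ← ∈-map⁻ !_ m = contract-∈ m (pvD⇓-sound d)
  pvG-sound {Γ} (r9 a b) = contract-duplicate Γ (⊗R (pvG-sound a) (pvG-sound b))
  pvG-sound (r10 t a) = ∃R t (pvG-sound a)

  pvD⇓-sound : ∀ {Γ D A} → pvD⇓ D (map !_ Γ) A → D ∷ map !_ Γ ⊢ A
  pvD⇓-sound {Γ} r5 = exch (++-comm (map !_ Γ) [ _ ]) (weaken⋆ Γ id)
  pvD⇓-sound {Γ} (r6 g) =
    subst (λ Θ → _ ∷ Θ ⊢ _) (++-identityʳ (map !_ Γ)) (⊸L (!R (pvG-sound g)) id)
  pvD⇓-sound (r7 t d) = ∀L t (pvD⇓-sound d)
  pvD⇓-sound (r8! d) = !D (pvD⇓-sound d)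

pvD⇑-sound : ∀ {Γ Δ G} → pvD⇑ (map !_ Γ) Δ G → map !_ Γ ++ Δ ⊢ G
pvD⇑-sound {Γ} (r2 {C = C} d) = from-front (map !_ Γ) (pvD⇑-sound {C ∷ Γ} d)
pvD⇑-sound {Γ} (r3 d e) =
  from-front (map !_ Γ) (⊕L (to-front (map !_ Γ) (pvD⇑-sound d))
                            (to-front (map !_ Γ) (pvD⇑-sound e)))
pvD⇑-sound {Γ} {G = G} (r4 g) = subst (_⊢ G) (sym (++-identityʳ (map !_ Γ))) (pvG-sound g)

pv-sound : ∀ {Δ G} → pv Δ G → map !_ Δ ⊢ G
pv-sound p = derelict-all (pvD⇑-sound {[]} p)

IsGoal-substF : ∀ σ {G} → IsGoal G → IsGoal (substF σ G)
IsGoal-substF σ (atom p ts) = atom p _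
IsGoal-substF σ (g₀ ⊗ g₁)   = IsGoal-substF σ g₀ ⊗ IsGoal-substF σ g₁
IsGoal-substF σ (∃' g)      = ∃' (IsGoal-substF (exts σ) g)

IsClause-substF : ∀ σ {C} → IsClause C → IsClause (substF σ C)
IsClause-substF σ (atom p ts) = atom p _
IsClause-substF σ (imp g)     = imp (IsGoal-substF σ g)
IsClause-substF σ (∀' c)      = ∀' (IsClause-substF (exts σ) c)

Admissible : List Formula → Formula → Set
Admissible 𝒫 C = ∀ {p ts} → pvD⇓ C 𝒫 (atom p ts) → pvG 𝒫 (atom p ts)

data Holds (𝒫 : List Formula) : Formula → Set where
  clause : ∀ {C} → IsClause C → Admissible 𝒫 C → Holds 𝒫 C
  !_     : ∀ {F} → Holds 𝒫 F → Holds 𝒫 (! F)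
  inj₁   : ∀ {F₀ F₁} → Holds 𝒫 F₀ → Holds 𝒫 (F₀ ⊕ F₁)
  inj₂   : ∀ {F₀ F₁} → Holds 𝒫 F₁ → Holds 𝒫 (F₀ ⊕ F₁)

data Conclusion : Formula → Set where
  goal  : ∀ {G} → IsGoal G → Conclusion G
  !goal : ∀ {G} → IsGoal G → Conclusion (! G)

goalOf : ∀ {C} → Conclusion C → Formula
goalOf (goal {G} _)  = G
goalOf (!goal {G} _) = G

member-holds : ∀ {𝒫 C} → IsClause C → ! C ∈ 𝒫 → Holds 𝒫 (! C)
member-holds c m = ! clause c (λ d → r8 m (r8! d))

goal-holds⇒pvG : ∀ {𝒫 G} → IsGoal G → Holds 𝒫 G → pvG 𝒫 G
goal-holds⇒pvG (atom p ts) (clause _ adm) = adm r5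
goal-holds⇒pvG (_ ⊗ _)     (clause () _)
goal-holds⇒pvG (∃' _)      (clause () _)

⊢⇒pvG : ∀ {𝒫 Γ C} → Γ ⊢ C → (c : Conclusion C) → All (Holds 𝒫) Γ → pvG 𝒫 (goalOf c)
⊢⇒pvG id (goal g)  (h ∷ [])   = goal-holds⇒pvG g h
⊢⇒pvG id (!goal g) (! h ∷ []) = goal-holds⇒pvG g h
⊢⇒pvG (exch p d) c hs = ⊢⇒pvG d c (All-resp-↭ (↭-sym p) hs)
⊢⇒pvG 𝟏R (goal ()) _
⊢⇒pvG (𝟏L _) _ (clause () _ ∷ _)
⊢⇒pvG ⊤R (goal ()) _
⊢⇒pvG 𝟎L _ (clause () _ ∷ _)
⊢⇒pvG (⊗R {Γ} d e) (goal (g₀ ⊗ g₁)) hs with hsΓ , hsΔ ← ++⁻ Γ hs =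
  r9 (⊢⇒pvG d (goal g₀) hsΓ) (⊢⇒pvG e (goal g₁) hsΔ)
⊢⇒pvG (⊗L _) _ (clause () _ ∷ _)
⊢⇒pvG (&R _ _) (goal ()) _
⊢⇒pvG (&L₁ _) _ (clause () _ ∷ _)
⊢⇒pvG (&L₂ _) _ (clause () _ ∷ _)
⊢⇒pvG (⊕R₁ _) (goal ()) _
⊢⇒pvG (⊕R₂ _) (goal ()) _
⊢⇒pvG (⊕L d e) c (inj₁ h ∷ hs) = ⊢⇒pvG d c (h ∷ hs)
⊢⇒pvG (⊕L d e) c (inj₂ h ∷ hs) = ⊢⇒pvG e c (h ∷ hs)
⊢⇒pvG (⊕L _ _) _ (clause () _ ∷ _)
⊢⇒pvG (⊸R _) (goal ()) _
⊢⇒pvG (⊸L {Γ} d e) c (clause (imp {p = p} {ts} g) adm ∷ hs) with hsΓ , hsΔ ← ++⁻ Γ hs =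
  ⊢⇒pvG e c (clause (atom p ts) (λ { r5 → adm (r6 (⊢⇒pvG d (!goal g) hsΓ)) }) ∷ hsΔ)
⊢⇒pvG (!R d) (!goal g) hs = ⊢⇒pvG d (goal g) hs
⊢⇒pvG (!R _) (goal ()) _
⊢⇒pvG (!W d) c (_ ∷ hs) = ⊢⇒pvG d c hs
⊢⇒pvG (!C d) c (h ∷ hs) = ⊢⇒pvG d c (h ∷ h ∷ hs)
⊢⇒pvG (!D d) c (! h ∷ hs) = ⊢⇒pvG d c (h ∷ hs)
⊢⇒pvG (!D _) _ (clause () _ ∷ _)
⊢⇒pvG (∀R _) (goal ()) _
⊢⇒pvG (∀L t d) c (clause (∀' cl) adm ∷ hs) =
  ⊢⇒pvG d c (clause (IsClause-substF _ cl) (λ r → adm (r7 t r)) ∷ hs)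
⊢⇒pvG (∃R t d) (goal (∃' g)) hs = r10 t (⊢⇒pvG d (goal (IsGoal-substF _ g)) hs)
⊢⇒pvG (∃L _) _ (clause () _ ∷ _)

-- The hypothesis is asked of every program that extends 𝒫, because the clauses
-- of Δ only hold in the program that pv has reached once Δ is exhausted.
mutual
  pvD⇑-intro : ∀ {G} 𝒫 {Δ} → All IsD Δ →
               (∀ 𝒫′ → 𝒫 ⊆ 𝒫′ → All (Holds 𝒫′) (map !_ Δ) → pvG 𝒫′ G) → pvD⇑ 𝒫 Δ G
  pvD⇑-intro 𝒫 []       k = r4 (k 𝒫 ⊆-refl [])
  pvD⇑-intro 𝒫 (i ∷ is) k = pvD⇑-intro-∷ 𝒫 i is k

  pvD⇑-intro-∷ : ∀ {G} 𝒫 {D Δ} → IsD D → All IsD Δ →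
                 (∀ 𝒫′ → 𝒫 ⊆ 𝒫′ → All (Holds 𝒫′) (map !_ (D ∷ Δ)) → pvG 𝒫′ G) →
                 pvD⇑ 𝒫 (D ∷ Δ) G
  pvD⇑-intro-∷ 𝒫 {D = ! C} (! c) is k =
    r2 (pvD⇑-intro (! C ∷ 𝒫) is λ 𝒫′ ⊆𝒫′ hs →
      k 𝒫′ (⊆-trans (xs⊆x∷xs 𝒫 (! C)) ⊆𝒫′) (! member-holds c (⊆𝒫′ (here refl)) ∷ hs))
  pvD⇑-intro-∷ 𝒫 (i₀ ⊕ i₁) is k =
    r3 (pvD⇑-intro-∷ 𝒫 i₀ is λ { 𝒫′ ⊆𝒫′ (! h ∷ hs) → k 𝒫′ ⊆𝒫′ (! inj₁ h ∷ hs) })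
       (pvD⇑-intro-∷ 𝒫 i₁ is λ { 𝒫′ ⊆𝒫′ (! h ∷ hs) → k 𝒫′ ⊆𝒫′ (! inj₂ h ∷ hs) })

pv-complete : ∀ {Δ G} → All IsD Δ → IsGoal G → map !_ Δ ⊢ G → pv Δ G
pv-complete isD isG d = pvD⇑-intro [] isD (λ _ _ hs → ⊢⇒pvG d (goal isG) hs)

mainTheorem1 : (Δ : List Formula) (G : Formula) → All IsD Δ → IsGoal G →
    (pv Δ G → map !_ Δ ⊢ G) × (map !_ Δ ⊢ G → pv Δ G)
mainTheorem1 Δ G isD isG = pv-sound , pv-complete isD isG
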